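{- Let $n\ge 1$ and let $T\in\mathbb{T}_n$ be an ordered tree. If $\mathit{NextTree}(T)$ returns null, then $T$ is the maximum element of $\mathbb{T}_n$; otherwise $\mathit{NextTree}(T)$ returns a tree of $\mathbb{T}_n$ that is immediately next to $T$ in $\mathbb{T}_n$.
   Context: Let $\mathbb{T}$ be the set of finite rooted trees in which every internal node has at least two children. For a node $v$, $T(v)$ is the subtree rooted at $v$ and $l(v)$ the number of leaves of $T(v)$; $\mathbb{T}_n=\{T\in\mathbb{T}:l(\mathrm{root}(T))=n\}$. For an integer $p\ge 2$, $\mathrm{Part}(p)$ is the set of non-decreasing sequences $(a_1,\dots,a_k)$ of positive integers with $k\ge 2$ and $\sum_i a_i=p$, ordered lexicographically: for distinct $a=(a_i)_k$, $b=(b_i)_m$, let $j$ be the least index $\le\min\{k,m\}$ with $a_j\ne b_j$; then $a<b$ iff $a_j<b_j$. Its maximum is $(\lfloor p/2\rfloor,\lceil p/2\rceil)$. Node comparison: define, by induction on the number of leaves, a comparison between nodes $v,w$ (of the same or different trees of $\mathbb{T}$) with outcomes $v<w$, $v\sim w$, or $w<v$: (1) if $l(v)<l(w)$ then $v<w$ (symmetrically); (2) if $l(v)=l(w)=1$ then $v\sim w$; (3) if $l(v)=l(w)\ge 2$, list the children of $v$ as $v_1,\dots,v_k$ and those of $w$ as $w_1,\dots,w_m$, each list non-decreasing with respect to this comparison (already defined for them); $(l(v_1),\dots,l(v_k))$ and $(l(w_1),\dots,l(w_m))\in\mathrm{Part}(l(v))$ are the partitions induced by $v$ and $w$. (3.1)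 If the partition induced by $v$ is lexicographically smaller (resp. larger) than that induced by $w$ then $v<w$ (resp. $w<v$). (3.2) If equal (so $k=m$): if $v_i\sim w_i$ for all $i$ then $v\sim w$; otherwise, with $j$ least such that $v_j\not\sim w_j$, $v<w$ if $v_j<w_j$ and $w<v$ otherwise. Write $v\le w$ if $v<w$ or $v\sim w$. For $T_1,T_2\in\mathbb{T}_n$, write $T_1<T_2$ (resp. $T_1\sim T_2$, $T_1\le T_2$) if $\mathrm{root}(T_1)<\mathrm{root}(T_2)$ (resp. $\sim$, $\le$). $T$ is the maximum element of $\mathbb{T}_n$ if $T'\le T$ for all $T'\in\mathbb{T}_n$; $T'\in\mathbb{T}_n$ is immediately next to $T$ if $T'>T$ and every $T''\in\mathbb{T}_n$ with $T''>T$ satisfies $T''\ge T'$. An ordered tree is a tree in $\mathbb{T}$ together with, for every internal node, an arrangement of its children as a sequence $v_1,\dots,v_k$ with $v_1\le\dots\le v_k$. For a node $x$ with parent $p$, the siblings of $x$ after $x$ are the children of $p$ arranged after $x$; the root has no siblings. A node $v$ is exhausted if it is a leaf or its induced partition is the maximum of $\mathrm{Part}(l(v))$. The inverted post-order traversal of an ordered tree traverses, for the root with children $v_1,\dots,v_k$ in their arrangement, the subtrees $T(v_k),\dots,T(v_1)$ recursively in inverted post-order and then visits the root. The pivot is the first visited node that is not exhausted, if any. Procedure $\mathit{NextTree}$, on input an ordered tree $T\in\mathbb{T}_n$: (i) find the pivot $v$; if none, return null. (ii) Let $b=(b_1,\dots,b_m)$ be the element of $\mathrm{Part}(l(v))$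 immediately next (in lexicographic order) to the partition induced by $v$. Replace $T(v)$ by the subtree in which $v$ has children $u_1,\dots,u_m$, arranged in this order, where $u_i$ is a leaf if $b_i=1$ and otherwise $u_i$ has exactly $b_i$ children, all leaves. (iii) Set $x:=v$ and repeat: for every sibling $y$ of $x$ after $x$, if $l(y)=l(x)$ replace $T(y)$ by a copy of the current $T(x)$, and otherwise replace $T(y)$ by the tree in which $y$ has exactly $l(y)$ children, all leaves; then set $x$ to be the parent of $x$; stop after the root has been processed. (iv) Return the resulting tree. -}

module Defs where

open import Data.Nat using (ℕ; zero; suc; _+_; _∸_; _≤_; _≤?_; _/_)
open import Data.Bool using (Bool; true; false; if_then_else_; _∧_)
open import Data.List using (List; []; _∷_; [_]; map; concatMap; filter; applyUpTo; replicate; length)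
open import Data.List.Relation.Unary.All using (All)
open import Data.List.Relation.Unary.Linked using (Linked)
open import Data.Maybe using (Maybe; just; nothing)
open import Data.Product using (_×_)
open import Data.Sum using (_⊎_)
open import Relation.Binary.PropositionalEquality using (_≡_)

-- For an *ordered* tree the list order is the arrangement of children.
-- For an element of 𝕋 (unordered) the list order is irrelevant: the
-- comparison below first sorts children.

data Tree : Set where
  leaf : Tree
  node : List Tree → Tree

mutual
  leaves : Tree → ℕ
  leaves leaf      = 1
  leaves (node ts) = leavesL ts

  leavesL : List Tree → ℕ
  leavesL []       = 0
  leavesL (t ∷ ts) = leaves t + leavesL ts

-- membership in 𝕋: every internal node has at least two children
data WF : Tree → Set where
  wf-leaf : WF leaf
  wf-node : ∀ {ts} → 2 ≤ length ts → All WF ts → WF (node ts)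

InT : ℕ → Tree → Set
InT n T = WF T × leaves T ≡ n

data Cmp : Set where
  lt eq gt : Cmp

cmpℕ : ℕ → ℕ → Cmp
cmpℕ zero    zero    = eq
cmpℕ zero    (suc _) = lt
cmpℕ (suc _) zero    = gt
cmpℕ (suc m) (suc n) = cmpℕ m n

_==ℕ_ : ℕ → ℕ → Bool
m ==ℕ n with cmpℕ m n
... | eq = true
... | _  = false

-- lexicographic comparison of sequences (as in the definition of the
-- order on Part(p); the prefix case never arises for partitions of the
-- same integer and is resolved arbitrarily)
lexℕ : List ℕ → List ℕ → Cmp
lexℕ []       []       = eq
lexℕ []       (_ ∷ _)  = lt
lexℕ (_ ∷ _)  []       = gt
lexℕ (a ∷ as) (b ∷ bs) with cmpℕ a b
... | eq = lexℕ as bs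
... | o  = o

-- Node comparison.  cmpC v w implements clauses (1),(2),(3.1),(3.2)
-- under the assumption that the children lists of all nodes of v and w
-- are already listed non-decreasingly; canon produces such a listing.

mutual
  cmpC : Tree → Tree → Cmp
  cmpC t u with cmpℕ (leaves t) (leaves u)
  ... | lt = lt
  ... | gt = gt
  ... | eq = if leaves t ==ℕ 1 then eq else cmpSame t u

  cmpSame : Tree → Tree → Cmp
  cmpSame (node ts) (node us) with lexℕ (map leaves ts) (map leaves us)
  ... | eq = cmpL ts us
  ... | o  = o
  cmpSame _ _ = eq

  cmpL : List Tree → List Tree → Cmp
  cmpL (x ∷ xs) (y ∷ ys) with cmpC x y
  ... | eq = cmpL xs ys
  ... | o  = o
  cmpL _ _ = eq

insert : Tree → List Tree → List Tree
insert x []       = x ∷ []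
insert x (y ∷ ys) with cmpC x y
... | gt = y ∷ insert x ys
... | _  = x ∷ y ∷ ys

isort : List Tree → List Tree
isort []       = []
isort (x ∷ xs) = insert x (isort xs)

mutual
  canon : Tree → Tree
  canon leaf      = leaf
  canon (node ts) = node (isort (canonL ts))

  canonL : List Tree → List Tree
  canonL []       = []
  canonL (t ∷ ts) = canon t ∷ canonL ts

cmpT : Tree → Tree → Cmp
cmpT v w = cmpC (canon v) (canon w)

_<T_ : Tree → Tree → Set
v <T w = cmpT v w ≡ lt

_∼T_ : Tree → Tree → Set
v ∼T w = cmpT v w ≡ eq

_≤T_ : Tree → Tree → Set
v ≤T w = (v <T w) ⊎ (v ∼T w)

IsMax : ℕ → Tree → Set
IsMax n T = ∀ T' → InT n T' → T' ≤T T

ImmNext : ℕ → Tree → Tree → Set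
ImmNext n T T' = (T <T T') × (∀ T'' → InT n T'' → T <T T'' → T' ≤T T'')

data Ordered : Tree → Set where
  ord-leaf : Ordered leaf
  ord-node : ∀ {ts} → All Ordered ts → Linked _≤T_ ts → Ordered (node ts)

-- gen f m s : all non-decreasing lists of integers ≥ max(m,1) with sum s
-- (f is fuel, f ≥ s suffices)
gen : ℕ → ℕ → ℕ → List (List ℕ)
gen _       _ zero    = [ [] ]
gen zero    _ (suc _) = []
gen (suc f) m (suc s) =
  concatMap (λ a → map (a ∷_) (gen f a (suc s ∸ a)))
            (filter (λ a → m ≤? a) (applyUpTo suc (suc s)))

Part : ℕ → List (List ℕ)
Part p = filter (λ c → 2 ≤? length c) (gen p 1 p)

minLex : List (List ℕ) → Maybe (List ℕ)
minLex []       = nothing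
minLex (c ∷ cs) with minLex cs
... | nothing = just c
... | just d  with lexℕ c d
...   | gt = just d
...   | _  = just c

nextPart : ℕ → List ℕ → Maybe (List ℕ)
nextPart p a = minLex (filter (λ c → cmpℕ' (lexℕ a c)) (Part p))
  where
  open import Relation.Nullary using (Dec; yes; no)
  open import Relation.Nullary.Decidable using (Dec)
  cmpℕ' : (o : Cmp) → Dec (o ≡ lt)
  cmpℕ' lt = yes _≡_.refl
  cmpℕ' eq = no (λ ())
  cmpℕ' gt = no (λ ())

_==L_ : List ℕ → List ℕ → Bool
[]       ==L []       = true
(a ∷ as) ==L (b ∷ bs) = (a ==ℕ b) ∧ (as ==L bs)
_        ==L _        = false

-- maximum of Part(p): (⌊p/2⌋, ⌈p/2⌉)
maxPart : ℕ → List ℕ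
maxPart p = (p / 2) ∷ (p ∸ p / 2) ∷ []


exhausted : Tree → Bool
exhausted leaf      = true
exhausted (node ts) = map leaves ts ==L maxPart (leavesL ts)

star : ℕ → Tree
star k = node (replicate k leaf)

mkChild : ℕ → Tree
mkChild b = if b ==ℕ 1 then leaf else star b

-- step (iii) at one level: x has been replaced by r; process siblings after x
fixSibs : Tree → List Tree → List Tree
fixSibs r = map (λ y → if leaves y ==ℕ leaves r then r else star (leaves y))

-- nextT T: the pivot is searched in inverted post-order (children from
-- last to first, then the node itself); the result is the subtree after
-- steps (ii) and (iii) have been carried out up to (the root of) T.
mutual
  nextT : Tree → Maybe Tree
  nextT leaf = nothing
  nextT (node ts) with nextKids ts
  ... | just ts' = just (node ts')
  ... | nothing  with exhausted (node ts)
  ...   | true  = nothing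
  ...   | false with nextPart (leavesL ts) (map leaves ts)
  ...     | nothing = nothing
  ...     | just b  = just (node (map mkChild b))

  -- list of children v₁ … v_k; subtrees later in the list are traversed first
  nextKids : List Tree → Maybe (List Tree)
  nextKids []       = nothing
  nextKids (t ∷ ts) with nextKids ts
  ... | just ts' = just (t ∷ ts')
  ... | nothing  with nextT t
  ...   | nothing = nothing
  ...   | just r  = just (r ∷ fixSibs r ts)

NextTree : Tree → Maybe Tree
NextTree = nextT

-- On sorted trees the comparison is lexicographic: first the number of
-- leaves, then the partition induced at the root, then the children from left
-- to right.  NextTree looks for the pivot from the right, so the result follows
-- by induction along that search.  If there is no pivot, every node is
-- exhausted and the tree is maximal.  If the pivot lies in a child whose later
-- siblings are all maximal, that child is replaced by its immediate successor r
-- and each later sibling by the least tree that may follow r (r itself or a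
-- star), which is the least larger list of children with the same partition.
-- If the pivot is the root, the next partition realised with least children
-- (leaves and stars) is the immediate successor.  The order on 𝕋 compares
-- sorted canonical forms and an ordered tree is its own canonical form, so
-- this transfers to 𝕋_n.

module Submission where

open import Defs
open import Data.Nat using (ℕ; zero; suc; _+_; _*_; _∸_; _≤_; _<_; _≤?_; _/_; z≤n; s≤s)
open import Data.Nat.Properties
open import Data.Nat.DivMod using (m*n/n≡m; /-monoˡ-≤; m/n*n≤m; m/n≤m)
open import Data.Nat.ListAction using (sum)
open import Data.Nat.ListAction.Properties using (sum-↭)
open import Data.Bool using (true; false; if_then_else_)
open import Data.List using (List; []; _∷_; map; filter; applyUpTo; replicate; length)
open import Data.List.Properties using (∷-injectiveˡ; ∷-injectiveʳ; length-map; length-replicate; map-replicate)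
open import Data.List.Relation.Unary.All as All using (All; []; _∷_)
open import Data.List.Relation.Unary.All.Properties using (replicate⁺)
open import Data.List.Relation.Unary.Any using (here; there)
open import Data.List.Relation.Unary.Linked as Linked using (Linked; []; [-]; _∷_)
import Data.List.Relation.Unary.Linked.Properties as Linked
open import Data.List.Relation.Binary.Pointwise using (Pointwise; []; _∷_; Pointwise-length)
open import Data.List.Relation.Binary.Permutation.Propositional
  using (_↭_; ↭-refl; ↭-sym; ↭-prep; ↭-swap; ↭-trans)
open import Data.List.Relation.Binary.Permutation.Propositional.Properties using (All-resp-↭; ↭-length)
import Data.List.Relation.Binary.Permutation.Propositional.Properties as ↭
open import Data.List.Membership.Propositional using (_∈_; find; lose)
open import Data.List.Membership.Propositional.Properties
  using (∈-map⁺; ∈-map⁻; ∈-concatMap⁺; ∈-concatMap⁻; ∈-applyUpTo⁺; ∈-applyUpTo⁻; ∈-filter⁺; ∈-filter⁻)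
open import Data.Maybe using (just; nothing)
open import Data.Maybe.Properties using (just-injective)
open import Data.Product using (_×_; _,_)
open import Data.Sum using (_⊎_; inj₁; inj₂)
open import Data.Empty using (⊥; ⊥-elim)
open import Data.Unit using (⊤; tt)
open import Function using (_∘_)
open import Relation.Nullary.Reflects using (Reflects; ofʸ; ofⁿ)
open import Relation.Binary.Core using (Rel)
open import Relation.Binary.Definitions using (Transitive)
open import Level using (0ℓ)
open import Relation.Binary.PropositionalEquality

-- Three-way comparisons

flipC : Cmp → Cmp
flipC lt = gt
flipC eq = eq
flipC gt = lt

thenC : Cmp → Cmp → Cmp
thenC lt _ = lt
thenC eq o = o
thenC gt _ = gt

NonGt : Cmp → Set
NonGt gt = ⊥
NonGt _  = ⊤

nonGt-lt : ∀ {o} → o ≡ lt → NonGt o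
nonGt-lt refl = tt

nonGt-eq : ∀ {o} → o ≡ eq → NonGt o
nonGt-eq refl = tt

nonGt⇒lt⊎eq : ∀ {o} → NonGt o → o ≡ lt ⊎ o ≡ eq
nonGt⇒lt⊎eq {lt} _ = inj₁ refl
nonGt⇒lt⊎eq {eq} _ = inj₂ refl

-- The transitivity table of a three-way comparison: if x, y, z are the outcomes
-- of comparing a with b, b with c and a with c, then Composes x y z.
Composes : Cmp → Cmp → Cmp → Set
Composes lt lt z = z ≡ lt
Composes lt eq z = z ≡ lt
Composes lt gt _ = ⊤
Composes eq y  z = z ≡ y
Composes gt lt _ = ⊤
Composes gt eq z = z ≡ gt
Composes gt gt z = z ≡ gt

composes-nonGt : ∀ {x y z} → Composes x y z → NonGt x → NonGt y → NonGt z
composes-nonGt {lt} {lt} refl _ _ = tt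
composes-nonGt {lt} {eq} refl _ _ = tt
composes-nonGt {eq} {lt} refl _ _ = tt
composes-nonGt {eq} {eq} refl _ _ = tt

composes-ltˡ : ∀ y → Composes lt y lt
composes-ltˡ lt = refl
composes-ltˡ eq = refl
composes-ltˡ gt = tt

composes-gtˡ : ∀ y → Composes gt y gt
composes-gtˡ lt = tt
composes-gtˡ eq = refl
composes-gtˡ gt = refl

composes-ltʳ : ∀ x → Composes x lt lt
composes-ltʳ lt = refl
composes-ltʳ eq = refl
composes-ltʳ gt = tt

composes-gtʳ : ∀ x → Composes x gt gt
composes-gtʳ lt = tt
composes-gtʳ eq = refl
composes-gtʳ gt = refl

thenC-composes : ∀ {x₁ y₁ z₁ x₂ y₂ z₂} → Composes x₁ y₁ z₁ →
  (x₁ ≡ eq → y₁ ≡ eq → Composes x₂ y₂ z₂) →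
  Composes (thenC x₁ x₂) (thenC y₁ y₂) (thenC z₁ z₂)
thenC-composes {lt} {lt} refl _ = refl
thenC-composes {lt} {eq} {y₂ = y₂} refl _ = composes-ltˡ y₂
thenC-composes {lt} {gt} _ _ = tt
thenC-composes {eq} {lt} {x₂ = x₂} refl _ = composes-ltʳ x₂
thenC-composes {eq} {eq} refl tie = tie refl refl
thenC-composes {eq} {gt} {x₂ = x₂} refl _ = composes-gtʳ x₂
thenC-composes {gt} {lt} _ _ = tt
thenC-composes {gt} {eq} {y₂ = y₂} refl _ = composes-gtˡ y₂
thenC-composes {gt} {gt} refl _ = refl

thenC-flip : ∀ {p p′ q q′} → p′ ≡ flipC p → (p ≡ eq → q′ ≡ flipC q) →
  thenC p′ q′ ≡ flipC (thenC p q)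
thenC-flip {lt} refl _ = refl
thenC-flip {eq} refl tie = tie refl
thenC-flip {gt} refl _ = refl

thenC-eq⁻ : ∀ {p q} → thenC p q ≡ eq → p ≡ eq × q ≡ eq
thenC-eq⁻ {eq} e = refl , e

thenC-nonGt : ∀ {p q} → NonGt p → (p ≡ eq → NonGt q) → NonGt (thenC p q)
thenC-nonGt {lt} _ _ = tt
thenC-nonGt {eq} _ tie = tie refl

thenC-nonGt⁻ : ∀ {p q} → NonGt (thenC p q) → NonGt p
thenC-nonGt⁻ {lt} _ = tt
thenC-nonGt⁻ {eq} _ = tt

-- Leastness of a lexicographic successor: thenC p q compares a pair with a
-- candidate above it, thenC p′ q′ compares the proposed successor with the
-- same candidate.
thenC-successorʳ : ∀ {p q q′} → (p ≡ eq → q ≡ lt → NonGt q′) →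
  thenC p q ≡ lt → NonGt (thenC p q′)
thenC-successorʳ {lt} _ _ = tt
thenC-successorʳ {eq} least above = least refl above

thenC-successorˡ : ∀ {p q p′ q′} → (p ≡ lt → NonGt p′) → (p′ ≡ eq → NonGt q′) →
  (p ≡ eq → q ≡ lt → ⊥) → thenC p q ≡ lt → NonGt (thenC p′ q′)
thenC-successorˡ {lt} least tie _ _ = thenC-nonGt (least refl) tie
thenC-successorˡ {eq} _ _ maximal above = ⊥-elim (maximal refl above)

record IsComparison {A : Set} (compare : A → A → Cmp) : Set where
  field
    reflexive  : ∀ a → compare a a ≡ eq
    flipped    : ∀ a b → compare b a ≡ flipC (compare a b)
    transitive : ∀ a b c → Composes (compare a b) (compare b c) (compare a c)

module ComparisonProperties {A : Set} {compare : A → A → Cmp} (isComparison : IsComparison compare) where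
  open IsComparison isComparison

  ≼-refl : ∀ a → NonGt (compare a a)
  ≼-refl a = nonGt-eq (reflexive a)

  ≼-trans : ∀ {a b c} → NonGt (compare a b) → NonGt (compare b c) → NonGt (compare a c)
  ≼-trans {a} {b} {c} = composes-nonGt (transitive a b c)

  gt⇒≼ : ∀ {a b} → compare a b ≡ gt → NonGt (compare b a)
  gt⇒≼ {a} {b} e rewrite flipped a b | e = tt

cmpℕ-refl : ∀ n → cmpℕ n n ≡ eq
cmpℕ-refl zero    = refl
cmpℕ-refl (suc n) = cmpℕ-refl n

cmpℕ-flip : ∀ m n → cmpℕ n m ≡ flipC (cmpℕ m n)
cmpℕ-flip zero    zero    = refl
cmpℕ-flip zero    (suc n) = refl
cmpℕ-flip (suc m) zero    = refl
cmpℕ-flip (suc m) (suc n) = cmpℕ-flip m n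

cmpℕ-trans : ∀ a b c → Composes (cmpℕ a b) (cmpℕ b c) (cmpℕ a c)
cmpℕ-trans zero    zero    zero    = refl
cmpℕ-trans zero    zero    (suc c) = refl
cmpℕ-trans zero    (suc b) zero    = tt
cmpℕ-trans zero    (suc b) (suc c) = composes-ltˡ (cmpℕ b c)
cmpℕ-trans (suc a) zero    zero    = refl
cmpℕ-trans (suc a) zero    (suc c) = tt
cmpℕ-trans (suc a) (suc b) zero    = composes-gtʳ (cmpℕ a b)
cmpℕ-trans (suc a) (suc b) (suc c) = cmpℕ-trans a b c

cmpℕ-eq⁻ : ∀ {m n} → cmpℕ m n ≡ eq → m ≡ n
cmpℕ-eq⁻ {zero}  {zero}  _ = refl
cmpℕ-eq⁻ {suc m} {suc n} e = cong suc (cmpℕ-eq⁻ e)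

cmpℕ-lt⁺ : ∀ {m n} → m < n → cmpℕ m n ≡ lt
cmpℕ-lt⁺ {zero}  {suc n} _       = refl
cmpℕ-lt⁺ {suc m} {suc n} (s≤s p) = cmpℕ-lt⁺ p

cmpℕ-nonGt⁺ : ∀ {m n} → m ≤ n → NonGt (cmpℕ m n)
cmpℕ-nonGt⁺ {zero}  {zero}  _       = tt
cmpℕ-nonGt⁺ {zero}  {suc n} _       = tt
cmpℕ-nonGt⁺ {suc m} {suc n} (s≤s p) = cmpℕ-nonGt⁺ p

cmpℕ-nonGt⁻ : ∀ {m n} → NonGt (cmpℕ m n) → m ≤ n
cmpℕ-nonGt⁻ {zero}          _ = z≤n
cmpℕ-nonGt⁻ {suc m} {suc n} p = s≤s (cmpℕ-nonGt⁻ p)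

==ℕ-reflects : ∀ m n → Reflects (m ≡ n) (m ==ℕ n)
==ℕ-reflects m n with cmpℕ m n in e
... | lt = ofⁿ λ { refl → lt≢eq (trans (sym e) (cmpℕ-refl m)) }
  where lt≢eq : lt ≢ eq
        lt≢eq ()
... | eq = ofʸ (cmpℕ-eq⁻ e)
... | gt = ofⁿ λ { refl → gt≢eq (trans (sym e) (cmpℕ-refl m)) }
  where gt≢eq : gt ≢ eq
        gt≢eq ()

==L-reflects : ∀ xs ys → Reflects (xs ≡ ys) (xs ==L ys)
==L-reflects []       []       = ofʸ refl
==L-reflects []       (_ ∷ _)  = ofⁿ λ ()
==L-reflects (_ ∷ _)  []       = ofⁿ λ ()
==L-reflects (x ∷ xs) (y ∷ ys) with x ==ℕ y | ==ℕ-reflects x y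
... | false | ofⁿ x≢y = ofⁿ (x≢y ∘ ∷-injectiveˡ)
... | true  | ofʸ refl with xs ==L ys | ==L-reflects xs ys
...   | true  | ofʸ refl  = ofʸ refl
...   | false | ofⁿ xs≢ys = ofⁿ (xs≢ys ∘ ∷-injectiveʳ)

lexℕ-∷ : ∀ a as b bs → lexℕ (a ∷ as) (b ∷ bs) ≡ thenC (cmpℕ a b) (lexℕ as bs)
lexℕ-∷ a as b bs with cmpℕ a b
... | lt = refl
... | eq = refl
... | gt = refl

lexℕ-refl : ∀ as → lexℕ as as ≡ eq
lexℕ-refl []       = refl
lexℕ-refl (a ∷ as) rewrite lexℕ-∷ a as a as | cmpℕ-refl a = lexℕ-refl as

lexℕ-flip : ∀ as bs → lexℕ bs as ≡ flipC (lexℕ as bs)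
lexℕ-flip []       []       = refl
lexℕ-flip []       (_ ∷ _)  = refl
lexℕ-flip (_ ∷ _)  []       = refl
lexℕ-flip (a ∷ as) (b ∷ bs) rewrite lexℕ-∷ a as b bs | lexℕ-∷ b bs a as =
  thenC-flip (cmpℕ-flip a b) (λ _ → lexℕ-flip as bs)

lexℕ-trans : ∀ as bs cs → Composes (lexℕ as bs) (lexℕ bs cs) (lexℕ as cs)
lexℕ-trans []       []       []       = refl
lexℕ-trans []       []       (_ ∷ _)  = refl
lexℕ-trans []       (_ ∷ _)  []       = tt
lexℕ-trans []       (b ∷ bs) (c ∷ cs) = composes-ltˡ (lexℕ (b ∷ bs) (c ∷ cs))
lexℕ-trans (_ ∷ _)  []       []       = refl
lexℕ-trans (_ ∷ _)  []       (_ ∷ _)  = tt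
lexℕ-trans (a ∷ as) (b ∷ bs) []       = composes-gtʳ (lexℕ (a ∷ as) (b ∷ bs))
lexℕ-trans (a ∷ as) (b ∷ bs) (c ∷ cs)
  rewrite lexℕ-∷ a as b bs | lexℕ-∷ b bs c cs | lexℕ-∷ a as c cs =
  thenC-composes (cmpℕ-trans a b c) (λ _ _ → lexℕ-trans as bs cs)

lexℕ-isComparison : IsComparison lexℕ
lexℕ-isComparison = record { reflexive = lexℕ-refl ; flipped = lexℕ-flip ; transitive = lexℕ-trans }

lexℕ-eq⁻ : ∀ {as bs} → lexℕ as bs ≡ eq → as ≡ bs
lexℕ-eq⁻ {[]}     {[]}     _ = refl
lexℕ-eq⁻ {a ∷ as} {b ∷ bs} e rewrite lexℕ-∷ a as b bs with thenC-eq⁻ e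
... | a≡b , as≡bs = cong₂ _∷_ (cmpℕ-eq⁻ a≡b) (lexℕ-eq⁻ as≡bs)

-- The comparison of trees

cmpTie : Tree → Tree → Cmp
cmpTie t u = if leaves t ==ℕ 1 then eq else cmpSame t u

cmpC-unfold : ∀ t u → cmpC t u ≡ thenC (cmpℕ (leaves t) (leaves u)) (cmpTie t u)
cmpC-unfold t u with cmpℕ (leaves t) (leaves u)
... | lt = refl
... | eq = refl
... | gt = refl

cmpSame-node : ∀ ts us →
  cmpSame (node ts) (node us) ≡ thenC (lexℕ (map leaves ts) (map leaves us)) (cmpL ts us)
cmpSame-node ts us with lexℕ (map leaves ts) (map leaves us)
... | lt = refl
... | eq = refl
... | gt = refl

cmpL-∷ : ∀ t ts u us → cmpL (t ∷ ts) (u ∷ us) ≡ thenC (cmpC t u) (cmpL ts us)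
cmpL-∷ t ts u us with cmpC t u
... | lt = refl
... | eq = refl
... | gt = refl

mutual
  cmpC-refl : ∀ t → cmpC t t ≡ eq
  cmpC-refl t rewrite cmpC-unfold t t | cmpℕ-refl (leaves t) = cmpTie-refl t

  cmpTie-refl : ∀ t → cmpTie t t ≡ eq
  cmpTie-refl t with leaves t ==ℕ 1
  ... | true  = refl
  ... | false = cmpSame-refl t

  cmpSame-refl : ∀ t → cmpSame t t ≡ eq
  cmpSame-refl leaf      = refl
  cmpSame-refl (node ts) rewrite cmpSame-node ts ts | lexℕ-refl (map leaves ts) = cmpL-refl ts

  cmpL-refl : ∀ ts → cmpL ts ts ≡ eq
  cmpL-refl []       = refl
  cmpL-refl (t ∷ ts) rewrite cmpL-∷ t ts t ts | cmpC-refl t = cmpL-refl ts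

mutual
  cmpC-flip : ∀ t u → cmpC u t ≡ flipC (cmpC t u)
  cmpC-flip t u rewrite cmpC-unfold t u | cmpC-unfold u t =
    thenC-flip (cmpℕ-flip (leaves t) (leaves u)) (λ e → cmpTie-flip t u (cmpℕ-eq⁻ e))

  cmpTie-flip : ∀ t u → leaves t ≡ leaves u → cmpTie u t ≡ flipC (cmpTie t u)
  cmpTie-flip t u same with leaves t ==ℕ 1 in e
  ... | true  rewrite sym same | e = refl
  ... | false rewrite sym same | e = cmpSame-flip t u

  cmpSame-flip : ∀ t u → cmpSame u t ≡ flipC (cmpSame t u)
  cmpSame-flip leaf      leaf      = refl
  cmpSame-flip leaf      (node _)  = refl
  cmpSame-flip (node _)  leaf      = refl
  cmpSame-flip (node ts) (node us) rewrite cmpSame-node ts us | cmpSame-node us ts =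
    thenC-flip (lexℕ-flip (map leaves ts) (map leaves us)) (λ _ → cmpL-flip ts us)

  cmpL-flip : ∀ ts us → cmpL us ts ≡ flipC (cmpL ts us)
  cmpL-flip []       []       = refl
  cmpL-flip []       (_ ∷ _)  = refl
  cmpL-flip (_ ∷ _)  []       = refl
  cmpL-flip (t ∷ ts) (u ∷ us) rewrite cmpL-∷ t ts u us | cmpL-∷ u us t ts =
    thenC-flip (cmpC-flip t u) (λ _ → cmpL-flip ts us)

mutual
  cmpC-trans : ∀ a b c → Composes (cmpC a b) (cmpC b c) (cmpC a c)
  cmpC-trans a b c rewrite cmpC-unfold a b | cmpC-unfold b c | cmpC-unfold a c =
    thenC-composes (cmpℕ-trans (leaves a) (leaves b) (leaves c))
                   (λ ab bc → cmpTie-trans a b c (cmpℕ-eq⁻ ab) (cmpℕ-eq⁻ bc))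

  cmpTie-trans : ∀ a b c → leaves a ≡ leaves b → leaves b ≡ leaves c →
    Composes (cmpTie a b) (cmpTie b c) (cmpTie a c)
  cmpTie-trans leaf      b         c         ab bc rewrite sym ab = refl
  cmpTie-trans (node ts) leaf      c         ab bc rewrite ab = refl
  cmpTie-trans (node ts) (node us) leaf      ab bc rewrite ab | bc = refl
  cmpTie-trans (node ts) (node us) (node vs) ab bc rewrite sym ab with leavesL ts ==ℕ 1
  ... | true  = refl
  ... | false = cmpSame-trans ts us vs

  cmpSame-trans : ∀ ts us vs →
    Composes (cmpSame (node ts) (node us)) (cmpSame (node us) (node vs)) (cmpSame (node ts) (node vs))
  cmpSame-trans ts us vs rewrite cmpSame-node ts us | cmpSame-node us vs | cmpSame-node ts vs =
    thenC-composes (lexℕ-trans (map leaves ts) (map leaves us) (map leaves vs))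
                   (λ tu uv → cmpL-trans ts us vs (lexℕ-eq⁻ tu) (lexℕ-eq⁻ uv))

  cmpL-trans : ∀ ts us vs → map leaves ts ≡ map leaves us → map leaves us ≡ map leaves vs →
    Composes (cmpL ts us) (cmpL us vs) (cmpL ts vs)
  cmpL-trans []       []       []       _  _  = refl
  cmpL-trans (t ∷ ts) (u ∷ us) (v ∷ vs) tu uv
    rewrite cmpL-∷ t ts u us | cmpL-∷ u us v vs | cmpL-∷ t ts v vs =
    thenC-composes (cmpC-trans t u v) (λ _ _ → cmpL-trans ts us vs (∷-injectiveʳ tu) (∷-injectiveʳ uv))

cmpC-isComparison : IsComparison cmpC
cmpC-isComparison = record { reflexive = cmpC-refl ; flipped = cmpC-flip ; transitive = cmpC-trans }

open ComparisonProperties cmpC-isComparison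

infix 4 _≼_ _≺_

_≼_ : Tree → Tree → Set
a ≼ b = NonGt (cmpC a b)

_≺_ : Tree → Tree → Set
a ≺ b = cmpC a b ≡ lt

Linked∷⇒All : ∀ {A : Set} {R : Rel A 0ℓ} → Transitive R → ∀ {x xs} → Linked R (x ∷ xs) → All (R x) xs
Linked∷⇒All trans     [-]       = []
Linked∷⇒All trans {x} (Rxy ∷ l) = Linked.Linked⇒All trans {x} Rxy l

Linked∷⇒All≼ : ∀ {x xs} → Linked _≼_ (x ∷ xs) → All (x ≼_) xs
Linked∷⇒All≼ = Linked∷⇒All (λ {a} {b} {c} → ≼-trans {a} {b} {c})

≼⇒leaves≤ : ∀ {a b} → a ≼ b → leaves a ≤ leaves b
≼⇒leaves≤ {a} {b} a≼b rewrite cmpC-unfold a b = cmpℕ-nonGt⁻ (thenC-nonGt⁻ a≼b)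

leaves<⇒≺ : ∀ {a b} → leaves a < leaves b → a ≺ b
leaves<⇒≺ {a} {b} p rewrite cmpC-unfold a b | cmpℕ-lt⁺ p = refl

leaves≡1⇒∼ : ∀ {a b} → leaves a ≡ 1 → leaves b ≡ 1 → cmpC a b ≡ eq
leaves≡1⇒∼ {a} {b} p q rewrite cmpC-unfold a b | p | q = refl

cmpC-node : ∀ ts us {n} → 2 ≤ n → leavesL ts ≡ n → leavesL us ≡ n →
  cmpC (node ts) (node us) ≡ thenC (lexℕ (map leaves ts) (map leaves us)) (cmpL ts us)
cmpC-node ts us n≥2 refl same
  rewrite cmpC-unfold (node ts) (node us) | same | cmpℕ-refl (leavesL ts)
  with leavesL ts ==ℕ 1 | ==ℕ-reflects (leavesL ts) 1
... | true  | ofʸ n≡1 = ⊥-elim (1+n≰n (subst (2 ≤_) n≡1 n≥2))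
... | false | _      = cmpSame-node ts us

-- Sorted trees and canonical forms

data Sorted : Tree → Set where
  sorted-leaf : Sorted leaf
  sorted-node : ∀ {ts} → All Sorted ts → Linked _≼_ ts → Sorted (node ts)

leavesL≡sum : ∀ ts → leavesL ts ≡ sum (map leaves ts)
leavesL≡sum []       = refl
leavesL≡sum (t ∷ ts) = cong (leaves t +_) (leavesL≡sum ts)

leavesL-↭ : ∀ {ts us} → ts ↭ us → leavesL ts ≡ leavesL us
leavesL-↭ {ts} {us} p = begin
  leavesL ts             ≡⟨ leavesL≡sum ts ⟩
  sum (map leaves ts)    ≡⟨ sum-↭ (↭.map⁺ leaves p) ⟩
  sum (map leaves us)    ≡⟨ leavesL≡sum us ⟨
  leavesL us             ∎
  where open ≡-Reasoning

insert-↭ : ∀ x ys → insert x ys ↭ x ∷ ys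
insert-↭ x []       = ↭-refl
insert-↭ x (y ∷ ys) with cmpC x y
... | lt = ↭-refl
... | eq = ↭-refl
... | gt = ↭-trans (↭-prep y (insert-↭ x ys)) (↭-swap y x ↭-refl)

isort-↭ : ∀ xs → isort xs ↭ xs
isort-↭ []       = ↭-refl
isort-↭ (x ∷ xs) = ↭-trans (insert-↭ x (isort xs)) (↭-prep x (isort-↭ xs))

insert-Linked : ∀ x ys → Linked _≼_ ys → Linked _≼_ (insert x ys)
insert-Linked x []       _ = [-]
insert-Linked x (y ∷ ys) l with cmpC x y in e
... | lt = nonGt-lt e ∷ l
... | eq = nonGt-eq e ∷ l
... | gt = insert-Linked-below x y ys (gt⇒≼ {x} {y} e) l
  where
  insert-Linked-below : ∀ x y ys → y ≼ x → Linked _≼_ (y ∷ ys) → Linked _≼_ (y ∷ insert x ys)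
  insert-Linked-below x y []       y≼x _ = y≼x ∷ [-]
  insert-Linked-below x y (z ∷ zs) y≼x (y≼z ∷ l) with cmpC x z in e
  ... | lt = y≼x ∷ nonGt-lt e ∷ l
  ... | eq = y≼x ∷ nonGt-eq e ∷ l
  ... | gt = y≼z ∷ insert-Linked-below x z zs (gt⇒≼ {x} {z} e) l

isort-Linked : ∀ xs → Linked _≼_ (isort xs)
isort-Linked []       = []
isort-Linked (x ∷ xs) = insert-Linked x (isort xs) (isort-Linked xs)

isort-id : ∀ {xs} → Linked _≼_ xs → isort xs ≡ xs
isort-id []  = refl
isort-id [-] = refl
isort-id {x ∷ y ∷ ys} (x≼y ∷ l) rewrite isort-id l with cmpC x y
... | lt = refl
... | eq = refl

mutual
  canon-Sorted : ∀ t → Sorted (canon t)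
  canon-Sorted leaf      = sorted-leaf
  canon-Sorted (node ts) =
    sorted-node (All-resp-↭ (↭-sym (isort-↭ (canonL ts))) (canonL-Sorted ts)) (isort-Linked (canonL ts))

  canonL-Sorted : ∀ ts → All Sorted (canonL ts)
  canonL-Sorted []       = []
  canonL-Sorted (t ∷ ts) = canon-Sorted t ∷ canonL-Sorted ts

mutual
  canon-leaves : ∀ t → leaves (canon t) ≡ leaves t
  canon-leaves leaf      = refl
  canon-leaves (node ts) = trans (leavesL-↭ (isort-↭ (canonL ts))) (canonL-leaves ts)

  canonL-leaves : ∀ ts → leavesL (canonL ts) ≡ leavesL ts
  canonL-leaves []       = refl
  canonL-leaves (t ∷ ts) = cong₂ _+_ (canon-leaves t) (canonL-leaves ts)

canonL-length : ∀ ts → length (canonL ts) ≡ length ts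
canonL-length []       = refl
canonL-length (_ ∷ ts) = cong suc (canonL-length ts)

mutual
  canon-WF : ∀ {t} → WF t → WF (canon t)
  canon-WF wf-leaf                 = wf-leaf
  canon-WF (wf-node {ts} k≥2 wfs) =
    wf-node (subst (2 ≤_) (sym (trans (↭-length (isort-↭ (canonL ts))) (canonL-length ts))) k≥2)
            (All-resp-↭ (↭-sym (isort-↭ (canonL ts))) (canonL-WF wfs))

  canonL-WF : ∀ {ts} → All WF ts → All WF (canonL ts)
  canonL-WF []         = []
  canonL-WF (wf ∷ wfs) = canon-WF wf ∷ canonL-WF wfs

mutual
  Sorted⇒canon-id : ∀ {t} → Sorted t → canon t ≡ t
  Sorted⇒canon-id sorted-leaf                 = refl
  Sorted⇒canon-id (sorted-node {ts} sorteds l) rewrite Sorted⇒canonL-id sorteds = cong node (isort-id l)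

  Sorted⇒canonL-id : ∀ {ts} → All Sorted ts → canonL ts ≡ ts
  Sorted⇒canonL-id []               = refl
  Sorted⇒canonL-id (sorted ∷ sorteds) = cong₂ _∷_ (Sorted⇒canon-id sorted) (Sorted⇒canonL-id sorteds)

cmpT-sortedˡ : ∀ {a b} → Sorted a → cmpT a b ≡ cmpC a (canon b)
cmpT-sortedˡ {a} {b} sa = cong (λ a′ → cmpC a′ (canon b)) (Sorted⇒canon-id sa)

cmpT-sortedʳ : ∀ {a b} → Sorted b → cmpT a b ≡ cmpC (canon a) b
cmpT-sortedʳ {a} {b} sb = cong (cmpC (canon a)) (Sorted⇒canon-id sb)

cmpT-sorted : ∀ {a b} → Sorted a → Sorted b → cmpT a b ≡ cmpC a b
cmpT-sorted {a} sa sb = trans (cmpT-sortedˡ sa) (cong (cmpC a) (Sorted⇒canon-id sb))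

≤T⇒nonGt : ∀ {a b} → a ≤T b → NonGt (cmpT a b)
≤T⇒nonGt (inj₁ e) = nonGt-lt e
≤T⇒nonGt (inj₂ e) = nonGt-eq e

mutual
  Ordered⇒Sorted : ∀ {t} → Ordered t → Sorted t
  Ordered⇒Sorted ord-leaf        = sorted-leaf
  Ordered⇒Sorted (ord-node os l) = sorted-node (Ordered⇒Sorteds os) (Ordered⇒Linked os l)

  Ordered⇒Sorteds : ∀ {ts} → All Ordered ts → All Sorted ts
  Ordered⇒Sorteds []       = []
  Ordered⇒Sorteds (o ∷ os) = Ordered⇒Sorted o ∷ Ordered⇒Sorteds os

  Ordered⇒Linked : ∀ {ts} → All Ordered ts → Linked _≤T_ ts → Linked _≼_ ts
  Ordered⇒Linked []            []        = []
  Ordered⇒Linked (_ ∷ [])      [-]       = [-]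
  Ordered⇒Linked {a ∷ b ∷ _} (oa ∷ ob ∷ os) (a≤b ∷ l) =
    subst NonGt (cmpT-sorted (Ordered⇒Sorted oa) (Ordered⇒Sorted ob)) (≤T⇒nonGt {a} {b} a≤b)
    ∷ Ordered⇒Linked (ob ∷ os) l

-- Partitions

module Lex = ComparisonProperties lexℕ-isComparison

record IsPartition (p : ℕ) (c : List ℕ) : Set where
  constructor isPartition
  field
    nondecreasing : Linked _≤_ c
    positive      : All (1 ≤_) c
    total         : sum c ≡ p
    parts≥2       : 2 ≤ length c

IsPartition⇒2≤ : ∀ {p c} → IsPartition p c → 2 ≤ p
IsPartition⇒2≤ {c = _ ∷ []} (isPartition _ _ _ (s≤s ()))
IsPartition⇒2≤ {c = a ∷ b ∷ rest} (isPartition _ (a≥1 ∷ b≥1 ∷ _) refl _) =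
  +-mono-≤ a≥1 (≤-trans b≥1 (m≤m+n b (sum rest)))

All≤⇒Linked∷ : ∀ {a c} → All (a ≤_) c → Linked _≤_ c → Linked _≤_ (a ∷ c)
All≤⇒Linked∷ []        _ = [-]
All≤⇒Linked∷ (a≤b ∷ _) l = a≤b ∷ l

∈-gen⁻ : ∀ f m s c → c ∈ gen f m s →
  Linked _≤_ c × All (m ≤_) c × All (1 ≤_) c × sum c ≡ s
∈-gen⁻ f       m zero    .[] (here refl) = [] , [] , [] , refl
∈-gen⁻ (suc f) m (suc s) c   c∈
  with find (∈-concatMap⁻ _ {xs = filter (m ≤?_) (applyUpTo suc (suc s))} c∈)
... | a , a∈ , c∈a with ∈-filter⁻ (m ≤?_) a∈ | ∈-map⁻ (a ∷_) c∈a
... | a∈′ , m≤a | c′ , c′∈ , refl with ∈-applyUpTo⁻ suc a∈′ | ∈-gen⁻ f a (suc s ∸ a) c′ c′∈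
... | i , i<s , refl | ↗ , a≤ , pos , total =
  All≤⇒Linked∷ a≤ ↗ , m≤a ∷ All.map (≤-trans m≤a) a≤ , s≤s z≤n ∷ pos ,
  trans (cong (suc i +_) total) (m+[n∸m]≡n i<s)

∈-gen⁺ : ∀ f m s c → Linked _≤_ c → All (m ≤_) c → All (1 ≤_) c → sum c ≡ s → s ≤ f →
  c ∈ gen f m s
∈-gen⁺ f m zero [] _ _ _ _ _ = here refl
∈-gen⁺ f m zero (_ ∷ _) _ _ (s≤s z≤n ∷ _) () _
∈-gen⁺ (suc f) m (suc s) (suc a ∷ c) ↗ (m≤a ∷ _) (_ ∷ pos) total (s≤s s≤f) =
  ∈-concatMap⁺ _ (lose {P = λ b → suc a ∷ c ∈ map (b ∷_) (gen f b (suc s ∸ b))}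
    (∈-filter⁺ (m ≤?_) (∈-applyUpTo⁺ suc a<1+s) m≤a)
    (∈-map⁺ (suc a ∷_)
      (∈-gen⁺ f (suc a) (suc s ∸ suc a) c (Linked.tail ↗) (Linked∷⇒All ≤-trans ↗) pos rest fuel)))
  where
  a<1+s : a < suc s
  a<1+s = s≤s (≤-trans (m≤m+n a (sum c)) (≤-pred (≤-reflexive total)))
  rest : sum c ≡ suc s ∸ suc a
  rest = trans (sym (m+n∸m≡n (suc a) (sum c))) (cong (_∸ suc a) total)
  fuel : suc s ∸ suc a ≤ f
  fuel = ≤-trans (m∸n≤m s a) s≤f

∈-Part⁻ : ∀ {p c} → c ∈ Part p → IsPartition p c
∈-Part⁻ {p} {c} c∈ with ∈-filter⁻ (λ c → 2 ≤? length c) c∈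
... | c∈gen , parts≥2 with ∈-gen⁻ p 1 p c c∈gen
... | ↗ , _ , pos , total = isPartition ↗ pos total parts≥2

∈-Part⁺ : ∀ {p c} → IsPartition p c → c ∈ Part p
∈-Part⁺ {p} {c} (isPartition ↗ pos total parts≥2) =
  ∈-filter⁺ (λ c → 2 ≤? length c) (∈-gen⁺ p 1 p c ↗ pos pos total ≤-refl) parts≥2

minLex-nothing : ∀ cs → minLex cs ≡ nothing → cs ≡ []
minLex-nothing []       _ = refl
minLex-nothing (c ∷ cs) e with minLex cs
minLex-nothing (c ∷ cs) () | nothing
... | just d with lexℕ c d
minLex-nothing (c ∷ cs) () | just d | lt
minLex-nothing (c ∷ cs) () | just d | eq
minLex-nothing (c ∷ cs) () | just d | gt

minLex-just : ∀ cs {d} → minLex cs ≡ just d → d ∈ cs × All (λ c → NonGt (lexℕ d c)) cs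
minLex-just (c ∷ cs) {m} e with minLex cs in e′
... | nothing rewrite minLex-nothing cs e′ | just-injective e = here refl , Lex.≼-refl m ∷ []
... | just d with lexℕ c d in c?d | minLex-just cs e′
...   | lt | _ , d≤cs rewrite sym (just-injective e) =
  here refl , Lex.≼-refl c ∷ All.map (Lex.≼-trans {c} {d} (nonGt-lt c?d)) d≤cs
...   | eq | _ , d≤cs rewrite sym (just-injective e) =
  here refl , Lex.≼-refl c ∷ All.map (Lex.≼-trans {c} {d} (nonGt-eq c?d)) d≤cs
...   | gt | d∈ , d≤cs rewrite sym (just-injective e) = there d∈ , Lex.gt⇒≼ {c} {d} c?d ∷ d≤cs

record IsNextPartition (p : ℕ) (a b : List ℕ) : Set where
  field
    partition : IsPartition p b
    above     : lexℕ a b ≡ lt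
    least     : ∀ {c} → IsPartition p c → lexℕ a c ≡ lt → NonGt (lexℕ b c)

nextPart-just : ∀ {p a b} → nextPart p a ≡ just b → IsNextPartition p a b
nextPart-just e with minLex-just _ e
... | b∈ , b≤ with ∈-filter⁻ _ b∈
... | b∈Part , a<b = record
  { partition = ∈-Part⁻ b∈Part
  ; above     = a<b
  ; least     = λ pc a<c → All.lookup b≤ (∈-filter⁺ _ (∈-Part⁺ pc) a<c)
  }

nextPart-nothing : ∀ {p a c} → IsPartition p c → lexℕ a c ≡ lt → nextPart p a ≢ nothing
nextPart-nothing pc a<c none with minLex-nothing _ none | ∈-filter⁺ _ (∈-Part⁺ pc) a<c
... | empty | c∈ with () ← subst (_ ∈_) empty c∈

half-bound : ∀ {a n} → a + a ≤ n → a ≤ n / 2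
half-bound {a} {n} a+a≤n = subst (_≤ n / 2) (m*n/n≡m a 2) (/-monoˡ-≤ 2 (subst (_≤ n) a+a≡a*2 a+a≤n))
  where
  a+a≡a*2 : a + a ≡ a * 2
  a+a≡a*2 = trans (cong (a +_) (sym (+-identityʳ a))) (*-comm 2 a)

half≤rest : ∀ n → n / 2 ≤ n ∸ n / 2
half≤rest n = m+n≤o⇒m≤o∸n (n / 2) (subst (_≤ n) half*2≡half+half (m/n*n≤m n 2))
  where
  half*2≡half+half : n / 2 * 2 ≡ n / 2 + n / 2
  half*2≡half+half = trans (*-comm (n / 2) 2) (cong (n / 2 +_) (+-identityʳ (n / 2)))

maxPart-isPartition : ∀ {n} → 2 ≤ n → IsPartition n (maxPart n)
maxPart-isPartition {n} n≥2 = isPartition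
  (half≤rest n ∷ [-])
  (half≥1 ∷ ≤-trans half≥1 (half≤rest n) ∷ [])
  (trans (cong (n / 2 +_) (+-identityʳ (n ∸ n / 2))) (m+[n∸m]≡n (m/n≤m n 2)))
  (s≤s (s≤s z≤n))
  where
  half≥1 : 1 ≤ n / 2
  half≥1 = /-monoˡ-≤ 2 n≥2

-- For c = a ∷ b ∷ rest we have a ≤ n / 2 because a ≤ b, and on a tie
-- b ≤ n ∸ a, with equality only if rest is empty.
maxPart-greatest : ∀ {n c} → IsPartition n c → NonGt (lexℕ c (maxPart n))
maxPart-greatest {c = _ ∷ []} (isPartition _ _ _ (s≤s ()))
maxPart-greatest {n} {a ∷ b ∷ rest} (isPartition (a≤b ∷ _) (_ ∷ _ ∷ pos) total _)
  rewrite lexℕ-∷ a (b ∷ rest) (n / 2) (n ∸ n / 2 ∷ []) | lexℕ-∷ b rest (n ∸ n / 2) [] =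
  thenC-nonGt (cmpℕ-nonGt⁺ a≤half)
    (λ a≡half → tie rest pos (subst (λ h → b + sum rest ≡ n ∸ h) (cmpℕ-eq⁻ {a} {n / 2} a≡half) b+rest))
  where
  b+rest : b + sum rest ≡ n ∸ a
  b+rest = trans (sym (m+n∸m≡n a (b + sum rest))) (cong (_∸ a) total)
  a≤half : a ≤ n / 2
  a≤half = half-bound (≤-trans (+-monoʳ-≤ a (≤-trans a≤b (m≤m+n b (sum rest)))) (≤-reflexive total))
  tie : ∀ rest → All (1 ≤_) rest → b + sum rest ≡ n ∸ n / 2 →
    NonGt (thenC (cmpℕ b (n ∸ n / 2)) (lexℕ rest []))
  tie []       _          e = thenC-nonGt (cmpℕ-nonGt⁺ (≤-trans (m≤m+n b 0) (≤-reflexive e))) (λ _ → tt)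
  tie (r ∷ rs) (r≥1 ∷ _) e
    rewrite cmpℕ-lt⁺ (<-≤-trans (m<m+n b (≤-trans r≥1 (m≤m+n r (sum rs)))) (≤-reflexive e)) = tt

nextPart-defined : ∀ {p a} → IsPartition p a → a ≢ maxPart p → nextPart p a ≢ nothing
nextPart-defined {p} {a} pa a≢max with lexℕ a (maxPart p) in e | maxPart-greatest pa
... | lt | _ = nextPart-nothing {a = a} (maxPart-isPartition (IsPartition⇒2≤ pa)) e
... | eq | _ = ⊥-elim (a≢max (lexℕ-eq⁻ {a} {maxPart p} e))

replicate-1-least : ∀ k {q} → All (1 ≤_) q → sum q ≡ k → NonGt (lexℕ (replicate k 1) q)
replicate-1-least zero    {[]}              _         _     = tt
replicate-1-least zero    {_ ∷ _}           (s≤s z≤n ∷ _) ()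
replicate-1-least (suc k) {suc zero ∷ q}    (_ ∷ pos) total
  rewrite lexℕ-∷ 1 (replicate k 1) 1 q = replicate-1-least k pos (suc-injective total)
replicate-1-least (suc k) {suc (suc a) ∷ q} _         _
  rewrite lexℕ-∷ 1 (replicate k 1) (suc (suc a)) q = tt

-- Sorted representatives of the elements of 𝕋_n

record Canonical (n : ℕ) (x : Tree) : Set where
  constructor canonical
  field
    wf     : WF x
    sorted : Sorted x
    size   : leaves x ≡ n

mutual
  WF⇒leaves≥1 : ∀ {t} → WF t → 1 ≤ leaves t
  WF⇒leaves≥1 wf-leaf           = s≤s z≤n
  WF⇒leaves≥1 (wf-node k≥2 wfs) = ≤-trans (s≤s z≤n) (WF-node⇒leaves≥2 (wf-node k≥2 wfs))

  WF-node⇒leaves≥2 : ∀ {ts} → WF (node ts) → 2 ≤ leavesL ts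
  WF-node⇒leaves≥2 {_ ∷ []} (wf-node (s≤s ()) _)
  WF-node⇒leaves≥2 {t ∷ u ∷ us} (wf-node _ (wt ∷ wu ∷ _)) =
    +-mono-≤ (WF⇒leaves≥1 wt) (≤-trans (WF⇒leaves≥1 wu) (m≤m+n (leaves u) (leavesL us)))

Canonicals⇒map-leaves : ∀ {ps xs} → Pointwise Canonical ps xs → map leaves xs ≡ ps
Canonicals⇒map-leaves []       = refl
Canonicals⇒map-leaves (c ∷ cs) = cong₂ _∷_ (Canonical.size c) (Canonicals⇒map-leaves cs)

Canonicals⇒positive : ∀ {ps xs} → Pointwise Canonical ps xs → All (1 ≤_) ps
Canonicals⇒positive []       = []
Canonicals⇒positive (c ∷ cs) =
  subst (1 ≤_) (Canonical.size c) (WF⇒leaves≥1 (Canonical.wf c)) ∷ Canonicals⇒positive cs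

children-canonical : ∀ {n xs ps} → Canonical n (node xs) → map leaves xs ≡ ps → Pointwise Canonical ps xs
children-canonical (canonical (wf-node _ wfs) (sorted-node sorteds _) _) refl = go wfs sorteds
  where
  go : ∀ {xs} → All WF xs → All Sorted xs → Pointwise Canonical (map leaves xs) xs
  go []         []               = []
  go (wf ∷ wfs) (sorted ∷ sorteds) = canonical wf sorted refl ∷ go wfs sorteds

node-canonical : ∀ {ps xs} → Pointwise Canonical ps xs → Linked _≼_ xs → 2 ≤ length ps →
  Canonical (sum ps) (node xs)
node-canonical {ps} {xs} cs l ps≥2 = canonical
  (wf-node (subst (2 ≤_) (Pointwise-length cs) ps≥2) (wfs cs))
  (sorted-node (sorteds cs) l)
  (trans (leavesL≡sum xs) (cong sum (Canonicals⇒map-leaves cs)))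
  where
  wfs : ∀ {ps xs} → Pointwise Canonical ps xs → All WF xs
  wfs []       = []
  wfs (c ∷ cs) = Canonical.wf c ∷ wfs cs
  sorteds : ∀ {ps xs} → Pointwise Canonical ps xs → All Sorted xs
  sorteds []       = []
  sorteds (c ∷ cs) = Canonical.sorted c ∷ sorteds cs

-- The trees built by NextTree

leavesL-replicate : ∀ k → leavesL (replicate k leaf) ≡ k
leavesL-replicate zero    = refl
leavesL-replicate (suc k) = cong suc (leavesL-replicate k)

replicate-leaf-Linked : ∀ k → Linked _≼_ (replicate k leaf)
replicate-leaf-Linked zero          = []
replicate-leaf-Linked (suc zero)    = [-]
replicate-leaf-Linked (suc (suc k)) = tt ∷ replicate-leaf-Linked (suc k)

star-canonical : ∀ {k} → 2 ≤ k → Canonical k (star k)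
star-canonical {k} k≥2 = canonical
  (wf-node (subst (2 ≤_) (sym (length-replicate k)) k≥2) (replicate⁺ k wf-leaf))
  (sorted-node (replicate⁺ k sorted-leaf) (replicate-leaf-Linked k))
  (leavesL-replicate k)

cmpL-replicate-leaf : ∀ k {xs} → map leaves xs ≡ replicate k 1 → cmpL (replicate k leaf) xs ≡ eq
cmpL-replicate-leaf zero    {[]}     _ = refl
cmpL-replicate-leaf (suc k) {x ∷ xs} e
  rewrite cmpL-∷ leaf (replicate k leaf) x xs | leaves≡1⇒∼ {leaf} {x} refl (∷-injectiveˡ e) =
  cmpL-replicate-leaf k (∷-injectiveʳ e)

-- Partitions are compared first, and (1, …, 1) is the least one.
star-least : ∀ {k x} → Canonical k x → star k ≼ x
star-least (canonical wf-leaf _ refl) = tt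
star-least {x = node xs} c@(canonical wf _ refl)
  rewrite cmpC-node (replicate (leavesL xs) leaf) xs (WF-node⇒leaves≥2 wf) (leavesL-replicate (leavesL xs)) refl
        | map-replicate leaves (leavesL xs) leaf =
  thenC-nonGt
    (replicate-1-least (leavesL xs) (Canonicals⇒positive (children-canonical c refl)) (sym (leavesL≡sum xs)))
    (λ tie → nonGt-eq (cmpL-replicate-leaf (leavesL xs) (sym (lexℕ-eq⁻ tie))))

mkChild-leaves : ∀ b → leaves (mkChild b) ≡ b
mkChild-leaves b with b ==ℕ 1 | ==ℕ-reflects b 1
... | true  | ofʸ refl = refl
... | false | _        = leavesL-replicate b

mkChild-canonical : ∀ {b} → 1 ≤ b → Canonical b (mkChild b)
mkChild-canonical {b} b≥1 with b ==ℕ 1 | ==ℕ-reflects b 1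
... | true  | ofʸ refl = canonical wf-leaf sorted-leaf refl
... | false | ofⁿ b≢1  = star-canonical (≤∧≢⇒< b≥1 (b≢1 ∘ sym))

mkChild-least : ∀ {b x} → Canonical b x → mkChild b ≼ x
mkChild-least {b} {x} c with b ==ℕ 1 | ==ℕ-reflects b 1
... | true  | ofʸ refl = nonGt-eq (leaves≡1⇒∼ {leaf} {x} refl (Canonical.size c))
... | false | _        = star-least c

mkChild-mono : ∀ {b₁ b₂} → b₁ ≤ b₂ → mkChild b₁ ≼ mkChild b₂
mkChild-mono {b₁} {b₂} b₁≤b₂ with m≤n⇒m<n∨m≡n b₁≤b₂
... | inj₂ refl = ≼-refl (mkChild b₁)
... | inj₁ b₁<b₂ = nonGt-lt (leaves<⇒≺ {mkChild b₁} {mkChild b₂}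
                     (subst₂ _<_ (sym (mkChild-leaves b₁)) (sym (mkChild-leaves b₂)) b₁<b₂))

mkChildren-canonical : ∀ {bs} → All (1 ≤_) bs → Pointwise Canonical bs (map mkChild bs)
mkChildren-canonical []           = []
mkChildren-canonical (b≥1 ∷ bs≥1) = mkChild-canonical b≥1 ∷ mkChildren-canonical bs≥1

mkChildren-Linked : ∀ {bs} → Linked _≤_ bs → Linked _≼_ (map mkChild bs)
mkChildren-Linked []          = []
mkChildren-Linked [-]         = [-]
mkChildren-Linked (b≤b′ ∷ bs) = mkChild-mono b≤b′ ∷ mkChildren-Linked bs

mkChildren-least : ∀ {bs xs} → Pointwise Canonical bs xs → NonGt (cmpL (map mkChild bs) xs)
mkChildren-least []                     = tt
mkChildren-least {b ∷ bs} {x ∷ xs} (c ∷ cs) rewrite cmpL-∷ (mkChild b) (map mkChild bs) x xs =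
  thenC-nonGt (mkChild-least c) (λ _ → mkChildren-least cs)

fixSib : Tree → Tree → Tree
fixSib r y = if leaves y ==ℕ leaves r then r else star (leaves y)

fixSib-leaves : ∀ r y → leaves (fixSib r y) ≡ leaves y
fixSib-leaves r y with leaves y ==ℕ leaves r | ==ℕ-reflects (leaves y) (leaves r)
... | true  | ofʸ same = sym same
... | false | _        = leavesL-replicate (leaves y)

fixSib-same : ∀ r y → leaves y ≡ leaves r → fixSib r y ≡ r
fixSib-same r y same with leaves y ==ℕ leaves r | ==ℕ-reflects (leaves y) (leaves r)
... | true  | _         = refl
... | false | ofⁿ other = ⊥-elim (other same)

fixSib-canonical : ∀ {r y} → Canonical (leaves r) r → leaves r ≤ leaves y → Canonical (leaves y) (fixSib r y)
fixSib-canonical {r} {y} c r≤y with leaves y ==ℕ leaves r | ==ℕ-reflects (leaves y) (leaves r)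
... | true  | ofʸ same  = subst (λ n → Canonical n r) (sym same) c
... | false | ofⁿ other =
  star-canonical (≤-trans (s≤s (WF⇒leaves≥1 (Canonical.wf c))) (≤∧≢⇒< r≤y (other ∘ sym)))

fixSib-≼ : ∀ r {y y′} → leaves y ≤ leaves y′ → fixSib r y ≼ fixSib r y′
fixSib-≼ r {y} {y′} y≤y′ with m≤n⇒m<n∨m≡n y≤y′
... | inj₁ y<y′ = nonGt-lt (leaves<⇒≺ {fixSib r y} {fixSib r y′}
                    (subst₂ _<_ (sym (fixSib-leaves r y)) (sym (fixSib-leaves r y′)) y<y′))
... | inj₂ same rewrite same = ≼-refl (fixSib r y′)

≼-fixSib : ∀ {r y} → leaves r ≤ leaves y → r ≼ fixSib r y
≼-fixSib {r} {y} r≤y with m≤n⇒m<n∨m≡n r≤y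
... | inj₁ r<y  = nonGt-lt (leaves<⇒≺ {r} {fixSib r y} (subst (leaves r <_) (sym (fixSib-leaves r y)) r<y))
... | inj₂ same rewrite fixSib-same r y (sym same) = ≼-refl r

fixSibs-canonical : ∀ {r ys} → Canonical (leaves r) r → All (λ y → leaves r ≤ leaves y) ys →
  Pointwise Canonical (map leaves ys) (fixSibs r ys)
fixSibs-canonical c []           = []
fixSibs-canonical {r} {y ∷ _} c (r≤y ∷ r≤ys) = fixSib-canonical {r} {y} c r≤y ∷ fixSibs-canonical c r≤ys

fixSibs-Linked : ∀ {r ys} → Linked _≼_ ys → All (λ y → leaves r ≤ leaves y) ys →
  Linked _≼_ (r ∷ fixSibs r ys)
fixSibs-Linked {r} {[]}    _ _         = [-]
fixSibs-Linked {r} {y ∷ _} l (r≤y ∷ _) =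
  ≼-fixSib {r} {y} r≤y
  ∷ Linked.map⁺ (Linked.map (λ {y} {y′} y≼y′ → fixSib-≼ r {y} {y′} (≼⇒leaves≤ {y} {y′} y≼y′)) l)

fixSib-least : ∀ {r x x′ y} → cmpC r x ≡ eq → x ≼ x′ → Canonical (leaves y) x′ → fixSib r y ≼ x′
fixSib-least {r} {x} {x′} {y} r∼x x≼x′ c with leaves y ==ℕ leaves r
... | true  = ≼-trans {r} {x} {x′} (nonGt-eq r∼x) x≼x′
... | false = star-least c

fixSibs-least : ∀ {r x ys xs} → cmpC r x ≡ eq → Pointwise Canonical (map leaves ys) xs → All (x ≼_) xs →
  NonGt (cmpL (fixSibs r ys) xs)
fixSibs-least {ys = []} r∼x [] [] = tt
fixSibs-least {r} {ys = y ∷ ys} {x′ ∷ xs} r∼x (c ∷ cs) (x≼x′ ∷ x≼xs)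
  rewrite cmpL-∷ (fixSib r y) (fixSibs r ys) x′ xs =
  thenC-nonGt {cmpC (fixSib r y) x′} (fixSib-least {r} {_} {x′} {y} r∼x x≼x′ c)
    (λ _ → fixSibs-least r∼x cs x≼xs)

-- The pivot search

IsMaximum : Tree → Set
IsMaximum t = ∀ {x} → Canonical (leaves t) x → x ≼ t

record IsSuccessor (t t′ : Tree) : Set where
  field
    isCanonical : Canonical (leaves t) t′
    above       : t ≺ t′
    least       : ∀ {x} → Canonical (leaves t) x → t ≺ x → t′ ≼ x

record IsListSuccessor (ts ts′ : List Tree) : Set where
  field
    areCanonical : Pointwise Canonical (map leaves ts) ts′
    linked       : Linked _≼_ ts′
    above        : cmpL ts ts′ ≡ lt
    least        : ∀ {xs} → Pointwise Canonical (map leaves ts) xs → Linked _≼_ xs →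
                   cmpL ts xs ≡ lt → NonGt (cmpL ts′ xs)
    lowerBounds  : ∀ {t} → Linked _≼_ (t ∷ ts) → Linked _≼_ (t ∷ ts′)

leaf-too-small : ∀ {n} → 2 ≤ n → Canonical n leaf → ⊥
leaf-too-small (s≤s ()) (canonical _ _ refl)

node-partition : ∀ {n xs} → Canonical n (node xs) → IsPartition n (map leaves xs)
node-partition {xs = xs} c@(canonical (wf-node k≥2 _) (sorted-node _ l) refl) = isPartition
  (Linked.map⁺ (Linked.map (λ {a} {b} → ≼⇒leaves≤ {a} {b}) l))
  (Canonicals⇒positive (children-canonical c refl))
  (sym (leavesL≡sum xs))
  (subst (2 ≤_) (sym (length-map leaves xs)) k≥2)


leaf-maximum : IsMaximum leaf
leaf-maximum {x} c = nonGt-eq (leaves≡1⇒∼ {x} {leaf} (Canonical.size c) refl)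

cmpL-maximum : ∀ {ts xs} → All IsMaximum ts → Pointwise Canonical (map leaves ts) xs → NonGt (cmpL xs ts)
cmpL-maximum {[]}     {[]}     []       []       = tt
cmpL-maximum {t ∷ ts} {x ∷ xs} (m ∷ ms) (c ∷ cs) rewrite cmpL-∷ x xs t ts =
  thenC-nonGt {cmpC x t} (m c) (λ _ → cmpL-maximum ms cs)

maximum-not-below : ∀ {ts xs} → All IsMaximum ts → Pointwise Canonical (map leaves ts) xs → cmpL ts xs ≢ lt
maximum-not-below {ts} {xs} ms cs below =
  subst NonGt (trans (cmpL-flip ts xs) (cong flipC below)) (cmpL-maximum ms cs)

exhausted⇒maximum : ∀ {ts} → All IsMaximum ts → WF (node ts) → map leaves ts ≡ maxPart (leavesL ts) →
  IsMaximum (node ts)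
exhausted⇒maximum ms wf _ c@(canonical wf-leaf _ _) = ⊥-elim (leaf-too-small (WF-node⇒leaves≥2 wf) c)
exhausted⇒maximum {ts} ms wf exh {node xs} c@(canonical _ _ size)
  rewrite cmpC-node xs ts (WF-node⇒leaves≥2 wf) size refl | exh =
  thenC-nonGt (maxPart-greatest (node-partition c))
    (λ tie → cmpL-maximum ms (children-canonical c (trans (lexℕ-eq⁻ tie) (sym exh))))

restart-successor : ∀ {ts b} → All IsMaximum ts → WF (node ts) → Sorted (node ts) →
  nextPart (leavesL ts) (map leaves ts) ≡ just b → IsSuccessor (node ts) (node (map mkChild b))
restart-successor {ts} {b} ms wf sorted found = record
  { isCanonical = subst (λ n → Canonical n (node (map mkChild b))) total
                    (node-canonical children (mkChildren-Linked nondecreasing) parts≥2)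
  ; above       = above′
  ; least       = least′
  }
  where
  open IsNextPartition (nextPart-just {leavesL ts} {map leaves ts} found)
  open IsPartition partition
  n≥2 : 2 ≤ leavesL ts
  n≥2 = WF-node⇒leaves≥2 wf
  children : Pointwise Canonical b (map mkChild b)
  children = mkChildren-canonical positive
  size : leavesL (map mkChild b) ≡ leavesL ts
  size = trans (leavesL≡sum (map mkChild b)) (trans (cong sum (Canonicals⇒map-leaves children)) total)
  above′ : node ts ≺ node (map mkChild b)
  above′ rewrite cmpC-node ts (map mkChild b) n≥2 refl size | Canonicals⇒map-leaves children | above = refl
  least′ : ∀ {x} → Canonical (leavesL ts) x → node ts ≺ x → node (map mkChild b) ≼ x
  least′ c@(canonical wf-leaf _ _) _ = ⊥-elim (leaf-too-small n≥2 c)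
  least′ {node xs} c@(canonical _ _ sizeₓ) below
    rewrite cmpC-node ts xs n≥2 refl sizeₓ | cmpC-node (map mkChild b) xs n≥2 size sizeₓ
          | Canonicals⇒map-leaves children =
    thenC-successorˡ (least (node-partition c))
      (λ tie → mkChildren-least {b} (children-canonical c (sym (lexℕ-eq⁻ tie))))
      (λ tie → maximum-not-below ms (children-canonical c (sym (lexℕ-eq⁻ tie))))
      below

children-successor⇒successor : ∀ {ts ts′} → WF (node ts) → IsListSuccessor ts ts′ →
  IsSuccessor (node ts) (node ts′)
children-successor⇒successor {ts} {ts′} wf@(wf-node k≥2 _) s = record
  { isCanonical = subst (λ n → Canonical n (node ts′)) (sym (leavesL≡sum ts))
                    (node-canonical areCanonical linked (subst (2 ≤_) (sym (length-map leaves ts)) k≥2))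
  ; above       = above′
  ; least       = least′
  }
  where
  open IsListSuccessor s
  n≥2 : 2 ≤ leavesL ts
  n≥2 = WF-node⇒leaves≥2 wf
  partition : map leaves ts′ ≡ map leaves ts
  partition = Canonicals⇒map-leaves areCanonical
  size : leavesL ts′ ≡ leavesL ts
  size = trans (leavesL≡sum ts′) (trans (cong sum partition) (sym (leavesL≡sum ts)))
  above′ : node ts ≺ node ts′
  above′ rewrite cmpC-node ts ts′ n≥2 refl size | partition | lexℕ-refl (map leaves ts) = above
  least′ : ∀ {x} → Canonical (leavesL ts) x → node ts ≺ x → node ts′ ≼ x
  least′ c@(canonical wf-leaf _ _) _ = ⊥-elim (leaf-too-small n≥2 c)
  least′ {node xs} c@(canonical _ (sorted-node _ lxs) sizeₓ) below
    rewrite cmpC-node ts xs n≥2 refl sizeₓ | cmpC-node ts′ xs n≥2 size sizeₓ | partition =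
    thenC-successorʳ (λ tie → least (children-canonical c (sym (lexℕ-eq⁻ tie))) lxs) below

tail-successor : ∀ {t ts ts′} → Canonical (leaves t) t → Linked _≼_ (t ∷ ts) → IsListSuccessor ts ts′ →
  IsListSuccessor (t ∷ ts) (t ∷ ts′)
tail-successor {t} {ts} {ts′} c lk s = record
  { areCanonical = c ∷ areCanonical
  ; linked       = lowerBounds lk
  ; above        = above′
  ; least        = least′
  ; lowerBounds  = λ { (u≼t ∷ _) → u≼t ∷ lowerBounds lk }
  }
  where
  open IsListSuccessor s
  above′ : cmpL (t ∷ ts) (t ∷ ts′) ≡ lt
  above′ rewrite cmpL-∷ t ts t ts′ | cmpC-refl t = above
  least′ : ∀ {xs} → Pointwise Canonical (map leaves (t ∷ ts)) xs → Linked _≼_ xs →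
    cmpL (t ∷ ts) xs ≡ lt → NonGt (cmpL (t ∷ ts′) xs)
  least′ {x ∷ xs} (_ ∷ cs) lxs below rewrite cmpL-∷ t ts x xs | cmpL-∷ t ts′ x xs =
    thenC-successorʳ (λ _ → least cs (Linked.tail lxs)) below

head-successor : ∀ {t r ts} → IsSuccessor t r → All IsMaximum ts → Linked _≼_ (t ∷ ts) →
  IsListSuccessor (t ∷ ts) (r ∷ fixSibs r ts)
head-successor {t} {r} {ts} s ms lk = record
  { areCanonical = isCanonical ∷ fixSibs-canonical r-canonical bounds
  ; linked       = linked′
  ; above        = above′
  ; least        = least′
  ; lowerBounds  = λ { {u} (u≼t ∷ _) → ≼-trans {u} {t} {r} u≼t (nonGt-lt above) ∷ linked′ }
  }
  where
  open IsSuccessor s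
  r-canonical : Canonical (leaves r) r
  r-canonical = canonical (Canonical.wf isCanonical) (Canonical.sorted isCanonical) refl
  bounds : All (λ y → leaves r ≤ leaves y) ts
  bounds = All.map (λ {y} t≼y → subst (_≤ leaves y) (sym (Canonical.size isCanonical)) (≼⇒leaves≤ {t} {y} t≼y))
                   (Linked∷⇒All≼ lk)
  linked′ : Linked _≼_ (r ∷ fixSibs r ts)
  linked′ = fixSibs-Linked (Linked.tail lk) bounds
  above′ : cmpL (t ∷ ts) (r ∷ fixSibs r ts) ≡ lt
  above′ rewrite cmpL-∷ t ts r (fixSibs r ts) | above = refl
  least′ : ∀ {xs} → Pointwise Canonical (map leaves (t ∷ ts)) xs → Linked _≼_ xs →
    cmpL (t ∷ ts) xs ≡ lt → NonGt (cmpL (r ∷ fixSibs r ts) xs)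
  least′ {x ∷ xs} (c ∷ cs) lxs below rewrite cmpL-∷ t ts x xs | cmpL-∷ r (fixSibs r ts) x xs =
    thenC-successorˡ (least c) (λ r∼x → fixSibs-least r∼x cs (Linked∷⇒All≼ lxs))
      (λ _ → maximum-not-below ms cs) below

exhausted-reflects : ∀ ts → Reflects (map leaves ts ≡ maxPart (leavesL ts)) (exhausted (node ts))
exhausted-reflects ts = ==L-reflects (map leaves ts) (maxPart (leavesL ts))

mutual
  nextT-nothing⇒maximum : ∀ {t} → WF t → Sorted t → nextT t ≡ nothing → IsMaximum t
  nextT-nothing⇒maximum {leaf} _ _ _ = leaf-maximum
  nextT-nothing⇒maximum {node ts} wf@(wf-node _ wfs) sorted@(sorted-node sorteds _) none
    with nextKids ts in kids
  ... | just _ with () ← none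
  ... | nothing with exhausted (node ts) | exhausted-reflects ts
  ...   | true  | ofʸ exh = exhausted⇒maximum (nextKids-nothing⇒maximum wfs sorteds kids) wf exh
  ...   | false | ofⁿ not-exh with nextPart (leavesL ts) (map leaves ts) in next
  ...     | just _  with () ← none
  ...     | nothing = ⊥-elim (nextPart-defined (node-partition (canonical wf sorted refl)) not-exh next)

  nextT-just⇒successor : ∀ {t t′} → WF t → Sorted t → nextT t ≡ just t′ → IsSuccessor t t′
  nextT-just⇒successor {node ts} wf@(wf-node _ wfs) sorted@(sorted-node sorteds lk) found
    with nextKids ts in kids
  ... | just _ with refl ← found =
    children-successor⇒successor wf (nextKids-just⇒successor wfs sorteds lk kids)
  ... | nothing with exhausted (node ts)
  ...   | true  with () ← found
  ...   | false with nextPart (leavesL ts) (map leaves ts) in next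
  ...     | nothing with () ← found
  ...     | just _  with refl ← found =
    restart-successor (nextKids-nothing⇒maximum wfs sorteds kids) wf sorted next

  nextKids-nothing⇒maximum : ∀ {ts} → All WF ts → All Sorted ts → nextKids ts ≡ nothing → All IsMaximum ts
  nextKids-nothing⇒maximum []         []         _ = []
  nextKids-nothing⇒maximum {t ∷ ts} (wf ∷ wfs) (sorted ∷ sorteds) none with nextKids ts in kids
  ... | just _ with () ← none
  ... | nothing with nextT t in here
  ...   | just _  with () ← none
  ...   | nothing = nextT-nothing⇒maximum wf sorted here ∷ nextKids-nothing⇒maximum wfs sorteds kids

  nextKids-just⇒successor : ∀ {ts ts′} → All WF ts → All Sorted ts → Linked _≼_ ts → nextKids ts ≡ just ts′ →
    IsListSuccessor ts ts′
  nextKids-just⇒successor {t ∷ ts} (wf ∷ wfs) (sorted ∷ sorteds) lk found with nextKids ts in kids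
  ... | just _ with refl ← found =
    tail-successor (canonical wf sorted refl) lk (nextKids-just⇒successor wfs sorteds (Linked.tail lk) kids)
  ... | nothing with nextT t in here
  ...   | nothing with () ← found
  ...   | just _  with refl ← found =
    head-successor (nextT-just⇒successor wf sorted here) (nextKids-nothing⇒maximum wfs sorteds kids) lk

canon-canonical : ∀ {n T} → InT n T → Canonical n (canon T)
canon-canonical {T = T} (wf , size) = canonical (canon-WF wf) (canon-Sorted T) (trans (canon-leaves T) size)

-- The hypothesis 1 ≤ n is automatic: every tree has a leaf.
theorem2 : (n : ℕ) → 1 ≤ n → (T : Tree) → InT n T → Ordered T →
    (NextTree T ≡ nothing → IsMax n T)
    × (∀ T' → NextTree T ≡ just T' → InT n T' × ImmNext n T T')
theorem2 _ _ T (wf , refl) ordered = isMax , isImmNext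
  where
  sorted : Sorted T
  sorted = Ordered⇒Sorted ordered
  isMax : NextTree T ≡ nothing → IsMax (leaves T) T
  isMax none T′ inT′ = nonGt⇒lt⊎eq (subst NonGt (sym (cmpT-sortedʳ {T′} sorted))
                         (nextT-nothing⇒maximum wf sorted none (canon-canonical inT′)))
  isImmNext : ∀ T′ → NextTree T ≡ just T′ → InT (leaves T) T′ × ImmNext (leaves T) T T′
  isImmNext T′ found = (wf′ , size′) , trans (cmpT-sorted sorted sorted′) above , least′
    where
    open IsSuccessor (nextT-just⇒successor wf sorted found)
    open Canonical isCanonical renaming (wf to wf′; sorted to sorted′; size to size′)
    least′ : ∀ T″ → InT (leaves T) T″ → T <T T″ → T′ ≤T T″
    least′ T″ inT″ T<T″ = nonGt⇒lt⊎eq (subst NonGt (sym (cmpT-sortedˡ {b = T″} sorted′))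
                            (least (canon-canonical inT″) (trans (sym (cmpT-sortedˡ {b = T″} sorted)) T<T″)))
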